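{- Let $\mathbf A=(A,\le,0,1)$ be a bounded MLUB-complete poset, $(T,R)$ a time frame with $R$ serial, $P,F,H,G$ the tense operators induced by $(T,R)$, and $\widehat G,\widehat P,\widehat H,\widehat F$ the operators on $\operatorname{DM}(\mathbf A)^T$ constructed by means of $(T,R)$. Then for all $C,D\in\mathcal P_+(A^T)$: (i) $\widehat G(L(C))=LU(G(UL(C)))=LU(G(C))$; (ii) $\widehat P(LU(D))=L(P(D))=L(P(LU(D)))$; (iii) $\widehat H(L(C))=LU(H(UL(C)))=LU(H(C))$; (iv) $\widehat F(LU(D))=L(F(D))=L(F(LU(D)))$.
   Context: For a poset and $X\subseteq A$: $L(X)$, $U(X)$ the sets of lower/upper bounds, $LU(X)=L(U(X))$, $UL(X)=U(L(X))$, $\operatorname{Max}X,\operatorname{Min}X$ the maximal/minimal elements. MLUB-complete: for every nonempty $M$, every upper bound of $M$ lies above a minimal upper bound and every lower bound below a maximal lower bound. $\mathcal P_+(X)$ = nonempty subsets. $A^T$ carries the componentwise order, and $L,U$ of subsets of $A^T$ refer to it; for $B\subseteq A^T$, $B(t)=\{q(t)\mid q\in B\}$. A time frame is $(T,R)$, $T\ne\emptyset$, $R\subseteq T^2$; serial: each $s$ has $r,t$ with $rRs$, $sRt$. Induced tense operators $P,F,H,G:\mathcal P_+(A^T)\to(\mathcal P_+A)^T$: $P(B)(s)=\operatorname{Min}U(\{q(t)\mid q\in B,tRs\})$, $F(B)(s)=\operatorname{Min}U(\{q(t)\mid q\in B,sRt\})$, $H(B)(s)=\operatorname{Max}L(\{q(t)\mid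 q\in B,tRs\})$, $G(B)(s)=\operatorname{Max}L(\{q(t)\mid q\in B,sRt\})$. $\operatorname{DM}(\mathbf A)=\{X\subseteq A\mid LU(X)=X\}$ ordered by inclusion is a complete lattice with meets $\bigcap$ and joins $\bigvee_iX_i=LU(\bigcup_iX_i)$. For $p\in\operatorname{DM}(\mathbf A)^T$: $\widehat G(p)(s)=\bigwedge\{p(t)\mid sRt\}$, $\widehat P(p)(s)=\bigvee\{p(t)\mid tRs\}$, $\widehat H(p)(s)=\bigwedge\{p(t)\mid tRs\}$, $\widehat F(p)(s)=\bigvee\{p(t)\mid sRt\}$. Identifications: a subset of $A^T$ of the form $\prod_tZ_t$ is identified with the function $t\mapsto Z_t$ (so $L(C)=\prod_tL(C(t))$ and $LU(D)=\prod_tLU(D(t))$ are elements of $\operatorname{DM}(\mathbf A)^T$); an element $Z\in(\mathcal P_+A)^T$ is identified with $\prod_tZ(t)$, and $L(Z)$, $LU(Z)$ are computed pointwise: $L(Z)(t)=L(Z(t))$, $LU(Z)(t)=LU(Z(t))$. -}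

module Defs where

open import Data.Product using (Σ; ∃; _×_; _,_)
open import Relation.Binary.PropositionalEquality using (_≡_)

Sub : Set → Set₁
Sub A = A → Set

NonEmpty : {A : Set} → Sub A → Set
NonEmpty {A} X = Σ A X

_⊆_ : {A : Set} → Sub A → Sub A → Set
X ⊆ Y = ∀ a → X a → Y a

_≐_ : {A : Set} → Sub A → Sub A → Set
X ≐ Y = (X ⊆ Y) × (Y ⊆ X)

_≐ᵀ_ : {T A : Set} → (T → Sub A) → (T → Sub A) → Set
p ≐ᵀ q = ∀ t → p t ≐ q t

Serial : {T : Set} → (T → T → Set) → Set
Serial {T} R = ∀ s → (Σ T λ r → R r s) × (Σ T λ t → R s t)

module Order {A : Set} (_≤_ : A → A → Set) where

  L : Sub A → Sub A
  L X a = ∀ x → X x → a ≤ x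

  U : Sub A → Sub A
  U X a = ∀ x → X x → x ≤ a

  LU : Sub A → Sub A
  LU X = L (U X)

  UL : Sub A → Sub A
  UL X = U (L X)

  Max : Sub A → Sub A
  Max X a = X a × (∀ b → X b → a ≤ b → b ≡ a)

  Min : Sub A → Sub A
  Min X a = X a × (∀ b → X b → b ≤ a → b ≡ a)

  IsBounded : A → A → Set
  IsBounded 𝟘 𝟙 = (∀ a → 𝟘 ≤ a) × (∀ a → a ≤ 𝟙)

  MLUB-complete : Set₁
  MLUB-complete = ∀ (M : Sub A) → NonEmpty M →
      (∀ a → U M a → Σ A λ m → Min (U M) m × (m ≤ a))
    × (∀ a → L M a → Σ A λ m → Max (L M) m × (a ≤ m))

module Tense {A : Set} (_≤_ : A → A → Set) {T : Set} (R : T → T → Set) where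
  open Order _≤_

  _at_ : Sub (T → A) → T → Sub A
  (B at t) a = Σ (T → A) λ q → B q × (q t ≡ a)

  past : Sub (T → A) → T → Sub A
  past B s a = Σ (T → A) λ q → Σ T λ t → B q × R t s × (q t ≡ a)

  future : Sub (T → A) → T → Sub A
  future B s a = Σ (T → A) λ q → Σ T λ t → B q × R s t × (q t ≡ a)

  P F H G : Sub (T → A) → T → Sub A
  P B s = Min (U (past B s))
  F B s = Min (U (future B s))
  H B s = Max (L (past B s))
  G B s = Max (L (future B s))

  -- Identifications from the paper:
  -- L(C) = ∏_t L(C(t)) viewed as the function t ↦ L(C(t)) ∈ DM(A)^T
  Lᵀ : Sub (T → A) → T → Sub A
  Lᵀ C t = L (C at t)

  -- LU(D) = ∏_t LU(D(t)) viewed as the function t ↦ LU(D(t)) ∈ DM(A)^T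
  LUᵀ : Sub (T → A) → T → Sub A
  LUᵀ D t = LU (D at t)

  -- UL(C) and LU(D) as subsets of A^T (products ∏_t UL(C(t)), ∏_t LU(D(t)))
  ULset : Sub (T → A) → Sub (T → A)
  ULset C q = ∀ t → UL (C at t) (q t)

  LUset : Sub (T → A) → Sub (T → A)
  LUset D q = ∀ t → LU (D at t) (q t)

  Lpw : (T → Sub A) → T → Sub A
  Lpw Z t = L (Z t)

  LUpw : (T → Sub A) → T → Sub A
  LUpw Z t = LU (Z t)

  -- Operators on DM(A)^T: meets are intersections, joins are LU of unions
  Ĝ P̂ Ĥ F̂ : (T → Sub A) → T → Sub A
  Ĝ p s a = ∀ t → R s t → p t a
  P̂ p s = LU (λ a → Σ T λ t → R t s × p t a)
  Ĥ p s a = ∀ t → R t s → p t a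
  F̂ p s = LU (λ a → Σ T λ t → R s t × p t a)

{-# OPTIONS --safe #-}
-- The operators Ĝ, Ĥ meet the sets L(C(t)) over the R-neighbours t, and a
-- meet of lower-bound sets is the lower-bound set of the union of the
-- neighbouring values; dually P̂, F̂ join the sets LU(D(t)), whose union has
-- the same upper bounds as the neighbouring values of D. MLUB-completeness
-- gives LU(Max L(X)) = L(X) and L(Min U(X)) = LU(X) for nonempty X, and
-- seriality makes the sets of neighbouring values nonempty. Replacing C by
-- UL(C), or D by LU(D), does not change these bound sets.
module Submission where

open import Data.Product using (_×_; Σ; _,_; proj₁; proj₂)
open import Level using (0ℓ) renaming (suc to lsuc)
open import Relation.Binary.Bundles using (Setoid)
open import Relation.Binary.Definitions using (Transitive)
open import Relation.Binary.PropositionalEquality using (_≡_; refl)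
open import Relation.Binary.Structures using (IsPartialOrder)
open import Defs

≐-setoid : Set → Setoid (lsuc 0ℓ) 0ℓ
≐-setoid A = record
  { Carrier       = Sub A
  ; _≈_           = _≐_
  ; isEquivalence = record
    { refl  = (λ _ x → x) , (λ _ x → x)
    ; sym   = λ (X⊆Y , Y⊆X) → Y⊆X , X⊆Y
    ; trans = λ (X⊆Y , Y⊆X) (Y⊆Z , Z⊆Y) →
                (λ a x → Y⊆Z a (X⊆Y a x)) , (λ a z → Y⊆X a (Z⊆Y a z))
    }
  }

module Bounds {A : Set} (_≤_ : A → A → Set) where
  open Order _≤_

  L-antitone : ∀ {X Y} → X ⊆ Y → L Y ⊆ L X
  L-antitone X⊆Y a a∈LY x x∈X = a∈LY x (X⊆Y x x∈X)

  U-antitone : ∀ {X Y} → X ⊆ Y → U Y ⊆ U X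
  U-antitone X⊆Y a a∈UY x x∈X = a∈UY x (X⊆Y x x∈X)

  L-cong : ∀ {X Y} → X ≐ Y → L X ≐ L Y
  L-cong (X⊆Y , Y⊆X) = L-antitone Y⊆X , L-antitone X⊆Y

  ⊆-UL : ∀ {X} → X ⊆ UL X
  ⊆-UL x x∈X a a∈LX = a∈LX x x∈X

  ⊆-LU : ∀ {X} → X ⊆ LU X
  ⊆-LU x x∈X a a∈UX = a∈UX x x∈X

  module _ (≤-trans : Transitive _≤_) (mlub : MLUB-complete) where

    LU-Max-L : ∀ X → NonEmpty X → LU (Max (L X)) ≐ L X
    LU-Max-L X X≢∅ =
        L-antitone (λ x x∈X → U-antitone (λ _ → proj₁) x (⊆-UL x x∈X))
      , λ a a∈LX u u∈UMax →
          let (m , m∈Max , a≤m) = proj₂ (mlub X X≢∅) a a∈LX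
          in  ≤-trans a≤m (u∈UMax m m∈Max)

    L-Min-U : ∀ X → NonEmpty X → L (Min (U X)) ≐ LU X
    L-Min-U X X≢∅ =
        (λ a a∈LMin u u∈UX →
          let (m , m∈Min , m≤u) = proj₁ (mlub X X≢∅) u u∈UX
          in  ≤-trans (a∈LMin m m∈Min) m≤u)
      , L-antitone (λ _ → proj₁)

module TenseBounds {A : Set} (_≤_ : A → A → Set) {T : Set} (R : T → T → Set) where
  open Order _≤_
  open Tense _≤_ R
  open Bounds _≤_
  open import Relation.Binary.Reasoning.Setoid (≐-setoid A)

  -- For Q = R s, values B Q is future B s and ⋀ p Q, ⋁ p Q are Ĝ p s, F̂ p s;
  -- for Q = λ t → R t s they are past B s, Ĥ p s and P̂ p s.
  values : Sub (T → A) → (T → Set) → Sub A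
  values B Q a = Σ (T → A) λ q → Σ T λ t → B q × Q t × (q t ≡ a)

  ⋀ : (T → Sub A) → (T → Set) → Sub A
  ⋀ p Q a = ∀ t → Q t → p t a

  ⋁ : (T → Sub A) → (T → Set) → Sub A
  ⋁ p Q = LU (λ a → Σ T λ t → Q t × p t a)

  values-nonEmpty : ∀ {B Q} → NonEmpty B → Σ T Q → NonEmpty (values B Q)
  values-nonEmpty (q , q∈B) (t , Qt) = q t , q , t , q∈B , Qt , refl

  values-mono : ∀ {B B′ Q} → B ⊆ B′ → values B Q ⊆ values B′ Q
  values-mono B⊆B′ a (q , t , q∈B , Qt , qt≡a) = q , t , B⊆B′ q q∈B , Qt , qt≡a

  ⊆-ULset : ∀ {C} → C ⊆ ULset C
  ⊆-ULset {C} q q∈C t = ⊆-UL (q t) (q , q∈C , refl)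

  ⊆-LUset : ∀ {D} → D ⊆ LUset D
  ⊆-LUset {D} q q∈D t = ⊆-LU (q t) (q , q∈D , refl)

  ⋀-Lᵀ≐L-values : ∀ C Q → ⋀ (Lᵀ C) Q ≐ L (values C Q)
  ⋀-Lᵀ≐L-values C Q =
      (λ { a a∈⋀ _ (q , t , q∈C , Qt , refl) → a∈⋀ t Qt (q t) (q , q∈C , refl) })
    , (λ { a a∈L t Qt _ (q , q∈C , refl) → a∈L (q t) (q , t , q∈C , Qt , refl) })

  L-values-ULset : ∀ C Q → L (values (ULset C) Q) ≐ L (values C Q)
  L-values-ULset C Q =
      L-antitone (values-mono ⊆-ULset)
    , λ { a a∈L _ (q , t , q∈ULC , Qt , refl) →
            q∈ULC t a λ { _ (q′ , q′∈C , refl) →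
              a∈L (q′ t) (q′ , t , q′∈C , Qt , refl) } }

  U-⋃-LUᵀ≐U-values : ∀ D Q → U (λ a → Σ T λ t → Q t × LUᵀ D t a) ≐ U (values D Q)
  U-⋃-LUᵀ≐U-values D Q =
      (λ { u u∈U _ (q , t , q∈D , Qt , refl) →
            u∈U (q t) (t , Qt , ⊆-LU (q t) (q , q∈D , refl)) })
    , (λ { u u∈U x (t , Qt , x∈LU) →
            x∈LU u (λ { _ (q , q∈D , refl) → u∈U (q t) (q , t , q∈D , Qt , refl) }) })

  U-values-LUset : ∀ D Q → U (values (LUset D) Q) ≐ U (values D Q)
  U-values-LUset D Q =
      U-antitone (values-mono ⊆-LUset)
    , λ { u u∈U _ (q , t , q∈LUD , Qt , refl) →
            q∈LUD t u λ { _ (q′ , q′∈D , refl) →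
              u∈U (q′ t) (q′ , t , q′∈D , Qt , refl) } }

  module Identities (≤-trans : Transitive _≤_) (mlub : MLUB-complete) where

    meet-identities : ∀ {C Q} → NonEmpty C → Σ T Q →
        (⋀ (Lᵀ C) Q ≐ LU (Max (L (values (ULset C) Q))))
      × (LU (Max (L (values (ULset C) Q))) ≐ LU (Max (L (values C Q))))
    meet-identities {C} {Q} C≢∅ t =
        (begin
          ⋀ (Lᵀ C) Q                         ≈⟨ ⋀-Lᵀ≐L-values C Q ⟩
          L (values C Q)                     ≈⟨ L-values-ULset C Q ⟨
          L (values (ULset C) Q)             ≈⟨ ULC-bounds ⟨
          LU (Max (L (values (ULset C) Q)))  ∎)
      , (begin
          LU (Max (L (values (ULset C) Q)))  ≈⟨ ULC-bounds ⟩
          L (values (ULset C) Q)             ≈⟨ L-values-ULset C Q ⟩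
          L (values C Q)                     ≈⟨ LU-Max-L ≤-trans mlub _ (values-nonEmpty C≢∅ t) ⟨
          LU (Max (L (values C Q)))          ∎)
      where
      ULC-bounds : LU (Max (L (values (ULset C) Q))) ≐ L (values (ULset C) Q)
      ULC-bounds = LU-Max-L ≤-trans mlub _
        (values-nonEmpty (let (q , q∈C) = C≢∅ in q , ⊆-ULset q q∈C) t)

    join-identities : ∀ {D Q} → NonEmpty D → Σ T Q →
        (⋁ (LUᵀ D) Q ≐ L (Min (U (values D Q))))
      × (L (Min (U (values D Q))) ≐ L (Min (U (values (LUset D) Q))))
    join-identities {D} {Q} D≢∅ t =
        (begin
          ⋁ (LUᵀ D) Q                        ≈⟨ L-cong (U-⋃-LUᵀ≐U-values D Q) ⟩
          LU (values D Q)                    ≈⟨ D-bounds ⟨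
          L (Min (U (values D Q)))           ∎)
      , (begin
          L (Min (U (values D Q)))           ≈⟨ D-bounds ⟩
          LU (values D Q)                    ≈⟨ L-cong (U-values-LUset D Q) ⟨
          LU (values (LUset D) Q)            ≈⟨ L-Min-U ≤-trans mlub _ LUD≢∅ ⟨
          L (Min (U (values (LUset D) Q)))   ∎)
      where
      D-bounds : L (Min (U (values D Q))) ≐ LU (values D Q)
      D-bounds = L-Min-U ≤-trans mlub _ (values-nonEmpty D≢∅ t)

      LUD≢∅ : NonEmpty (values (LUset D) Q)
      LUD≢∅ = values-nonEmpty (let (q , q∈D) = D≢∅ in q , ⊆-LUset q q∈D) t

unzip : {T : Set} {X Y : T → Set} → (∀ s → X s × Y s) → (∀ s → X s) × (∀ s → Y s)
unzip h = (λ s → proj₁ (h s)) , (λ s → proj₂ (h s))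

corollary4p2 : {A : Set} (_≤_ : A → A → Set) → IsPartialOrder _≡_ _≤_ →
    (𝟘 𝟙 : A) → Order.IsBounded _≤_ 𝟘 𝟙 → Order.MLUB-complete _≤_ →
    {T : Set} (R : T → T → Set) → Serial R →
    (C D : Sub (T → A)) → NonEmpty C → NonEmpty D →
    let open Tense _≤_ R in
      ((Ĝ (Lᵀ C) ≐ᵀ LUpw (G (ULset C))) × (LUpw (G (ULset C)) ≐ᵀ LUpw (G C)))
    × ((P̂ (LUᵀ D) ≐ᵀ Lpw (P D)) × (Lpw (P D) ≐ᵀ Lpw (P (LUset D))))
    × ((Ĥ (Lᵀ C) ≐ᵀ LUpw (H (ULset C))) × (LUpw (H (ULset C)) ≐ᵀ LUpw (H C)))
    × ((F̂ (LUᵀ D) ≐ᵀ Lpw (F D)) × (Lpw (F D) ≐ᵀ Lpw (F (LUset D))))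
corollary4p2 _≤_ ≤-po _ _ _ mlub R serial C D C≢∅ D≢∅ =
    unzip (λ s → meet-identities C≢∅ (proj₂ (serial s)))
  , unzip (λ s → join-identities D≢∅ (proj₁ (serial s)))
  , unzip (λ s → meet-identities C≢∅ (proj₁ (serial s)))
  , unzip (λ s → join-identities D≢∅ (proj₂ (serial s)))
  where
  open IsPartialOrder ≤-po using (trans)
  open TenseBounds.Identities _≤_ R trans mlub
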